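{- If $F$ is a tightly connected $r$-graph, then $F$ has an $r$-partition which is unique up to relabeling the parts.
   Context: An $r$-graph is an $r$-uniform hypergraph. An $r$-partition of an $r$-graph is a partition $U_1\cup\cdots\cup U_r$ of its vertex set such that every edge contains exactly one vertex of each $U_i$. An $r$-partite $r$-graph $F$ with $r$-partition $U_1\cup\cdots\cup U_r$ is tightly connected if for every $i$ and all distinct $u_1,u_2\in U_i$ there exist edges $e_1,e_2$ of $F$ with $u_1\in e_1$, $u_2\in e_2$ and $|e_1\cap e_2|=r-1$. -}

module Defs where

open import Level using (0ℓ)
open import Data.Nat using (ℕ; _∸_)
open import Data.Fin using (Fin)
open import Data.Fin.Subset using (Subset; _∈_; _∩_; ∣_∣)
open import Data.Fin.Permutation using (Permutation′; _⟨$⟩ʳ_)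
open import Data.Product using (Σ; ∃; ∃-syntax; _×_)
open import Relation.Binary.PropositionalEquality using (_≡_; _≢_)

record RGraph (r : ℕ) : Set₁ where
  field
    n       : ℕ
    Edge    : Subset n → Set
    uniform : ∀ e → Edge e → ∣ e ∣ ≡ r
open RGraph public

-- A partition U_1 ∪ ... ∪ U_r of the vertex set is encoded by the
-- labelling χ : V → Fin r (U_i = χ⁻¹(i)); parts of a partition are nonempty.
IsPartition : ∀ {r} (F : RGraph r) → (Fin (n F) → Fin r) → Set
IsPartition {r} F χ = ∀ (i : Fin r) → ∃[ v ] χ v ≡ i

IsRPartition : ∀ {r} (F : RGraph r) → (Fin (n F) → Fin r) → Set
IsRPartition {r} F χ =
  IsPartition F χ ×
  (∀ e → Edge F e → ∀ (i : Fin r) →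
     ∃[ v ] (v ∈ e × χ v ≡ i × (∀ w → w ∈ e → χ w ≡ i → w ≡ v)))

TightlyConnectedWrt : ∀ {r} (F : RGraph r) → (Fin (n F) → Fin r) → Set
TightlyConnectedWrt {r} F χ =
  ∀ (i : Fin r) (u₁ u₂ : Fin (n F)) → χ u₁ ≡ i → χ u₂ ≡ i → u₁ ≢ u₂ →
    ∃[ e₁ ] ∃[ e₂ ] (Edge F e₁ × Edge F e₂ × u₁ ∈ e₁ × u₂ ∈ e₂ ×
                     ∣ e₁ ∩ e₂ ∣ ≡ r ∸ 1)

TightlyConnected : ∀ {r} → RGraph r → Set
TightlyConnected F = ∃[ χ ] (IsRPartition F χ × TightlyConnectedWrt F χ)

SameUpToRelabel : ∀ {r} (F : RGraph r) → (χ χ' : Fin (n F) → Fin r) → Set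
SameUpToRelabel {r} F χ χ' = Σ (Permutation′ r) (λ σ → ∀ v → χ' v ≡ (σ ⟨$⟩ʳ χ v))

-- Tight connectivity with respect to χ forces every r-partition χ' to be
-- constant on the parts of χ: if u₁ ≠ u₂ lie in one part of χ but in
-- different parts of χ', take edges e₁ ∋ u₁, e₂ ∋ u₂ sharing r − 1 vertices.
-- Then u₁ ∉ e₂, and the vertex w of e₁ in the χ'-part of u₂ is also outside
-- e₂; but e₁ has r vertices, r − 1 of them in e₂. Hence χ' = π ∘ χ for a
-- map π : Fin r → Fin r which is onto because χ' is, hence a permutation.
module Submission where

open import Defs
open import Data.Nat using (ℕ; zero; suc; _+_; _∸_; _≤_; s≤s)
open import Data.Nat.Properties using (1+n≰n; ≤-pred; ≤-trans)
open import Data.Fin using (Fin; punchOut)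
open import Data.Fin.Properties using (_≟_; any?; punchOut-injective; injective⇒≤)
open import Data.Fin.Subset using (Subset; _∈_; _∉_; _∩_; ∣_∣; _⊆_; _⊂_; _-_)
open import Data.Fin.Subset.Properties
  using (x∈p∩q⁻; x∈p∧x≢y⇒x∈p-y; x∈p⇒∣p-x∣<∣p∣; p⊂q⇒∣p∣<∣q∣)
open import Data.Fin.Permutation using (Permutation′; _⟨$⟩ʳ_; permutation)
open import Data.Product using (Σ; ∃-syntax; _×_; _,_; proj₁; proj₂)
open import Data.Empty using (⊥-elim)
open import Function.Base using (_∘_)
open import Function.Definitions using (Injective)
open import Relation.Binary.PropositionalEquality
open import Relation.Nullary using (yes; no; ¬_)

private
  variable
    A : Set
    m r : ℕ

injective⇒surjective : {f : Fin m → Fin m} → Injective _≡_ _≡_ f →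
                       ∀ j → ∃[ i ] f i ≡ j
injective⇒surjective {zero}  _ ()
injective⇒surjective {suc m} {f} f-inj j with any? (λ i → f i ≟ j)
... | yes hit = hit
... | no miss = ⊥-elim (1+n≰n (injective⇒≤ g-inj))
  where
  g : Fin (suc m) → Fin m
  g i = punchOut {i = j} (λ j≡fi → miss (i , sym j≡fi))

  g-inj : Injective _≡_ _≡_ g
  g-inj {x} {y} gx≡gy = f-inj (punchOut-injective
    (λ j≡fx → miss (x , sym j≡fx)) (λ j≡fy → miss (y , sym j≡fy)) gx≡gy)

rightInverse⇒permutation : (f g : Fin m → Fin m) → (∀ j → f (g j) ≡ j) →
                           Permutation′ m
rightInverse⇒permutation f g f∘g≗id = permutation f g f∘g≗id g∘f≗id
  where
  g-inj : Injective _≡_ _≡_ g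
  g-inj {a} {b} ga≡gb = trans (sym (f∘g≗id a)) (trans (cong f ga≡gb) (f∘g≗id b))

  g∘f≗id : ∀ i → g (f i) ≡ i
  g∘f≗id i with injective⇒surjective g-inj i
  ... | j , refl = cong g (f∘g≗id j)

FibresRefine : (A → Fin r) → (A → Fin r) → Set
FibresRefine f g = ∀ a b → f a ≡ f b → g a ≡ g b

refines⇒relabelling : (f g : A → Fin r) →
                      (∀ i → ∃[ a ] f a ≡ i) → (∀ j → ∃[ a ] g a ≡ j) →
                      FibresRefine f g →
                      Σ (Permutation′ r) (λ π → ∀ a → g a ≡ π ⟨$⟩ʳ f a)
refines⇒relabelling f g f-onto g-onto f≼g =
  rightInverse⇒permutation π π⁻¹ π∘π⁻¹≗id ,
  λ a → f≼g a (proj₁ (f-onto (f a))) (sym (proj₂ (f-onto (f a))))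
  where
  π π⁻¹ : Fin _ → Fin _
  π   i = g (proj₁ (f-onto i))
  π⁻¹ j = f (proj₁ (g-onto j))

  π∘π⁻¹≗id : ∀ j → π (π⁻¹ j) ≡ j
  π∘π⁻¹≗id j = trans (f≼g _ _ (proj₂ (f-onto (π⁻¹ j)))) (proj₂ (g-onto j))

2+∣p∩q∣≤∣p∣ : ∀ {n} {p q : Subset n} {x y} → x ≢ y →
              x ∈ p → y ∈ p → x ∉ q → y ∉ q → 2 + ∣ p ∩ q ∣ ≤ ∣ p ∣
2+∣p∩q∣≤∣p∣ {p = p} {q} {x} {y} x≢y x∈p y∈p x∉q y∉q =
  ≤-trans (s≤s (p⊂q⇒∣p∣<∣q∣ p∩q⊂p-x)) (x∈p⇒∣p-x∣<∣p∣ x∈p)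
  where
  p∩q⊆p-x : p ∩ q ⊆ p - x
  p∩q⊆p-x z∈p∩q with x∈p∩q⁻ p q z∈p∩q
  ... | z∈p , z∈q = x∈p∧x≢y⇒x∈p-y z∈p (λ { refl → x∉q z∈q })

  p∩q⊂p-x : p ∩ q ⊂ p - x
  p∩q⊂p-x = p∩q⊆p-x , y , x∈p∧x≢y⇒x∈p-y y∈p (x≢y ∘ sym)
                        , λ y∈p∩q → y∉q (proj₂ (x∈p∩q⁻ p q y∈p∩q))

2+r∸1≰r : ∀ r → ¬ (2 + (r ∸ 1) ≤ r)
2+r∸1≰r zero    ()
2+r∸1≰r (suc r) 2+r≤1+r = 1+n≰n (≤-pred 2+r≤1+r)

module _ {r} (F : RGraph r) where

  sameLabel-inEdge⇒≡ : ∀ {χ} → IsRPartition F χ → ∀ {e} → Edge F e →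
                       ∀ {u v} → u ∈ e → v ∈ e → χ u ≡ χ v → u ≡ v
  sameLabel-inEdge⇒≡ (_ , rainbow) E {u} {v} u∈e v∈e χu≡χv
    with rainbow _ E _
  ... | _ , _ , _ , unique = trans (unique u u∈e χu≡χv) (sym (unique v v∈e refl))

  tightlyConnected⇒fibresRefine : ∀ {χ χ'} → IsRPartition F χ → TightlyConnectedWrt F χ →
                                  IsRPartition F χ' → FibresRefine χ χ'
  tightlyConnected⇒fibresRefine {χ} {χ'} rp tc rp' u₁ u₂ χu₁≡χu₂ with u₁ ≟ u₂
  ... | yes refl = refl
  ... | no u₁≢u₂ with χ' u₁ ≟ χ' u₂
  ...   | yes χ'u₁≡χ'u₂ = χ'u₁≡χ'u₂
  ...   | no  χ'u₁≢χ'u₂ with tc _ u₁ u₂ χu₁≡χu₂ refl u₁≢u₂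
  ...     | e₁ , e₂ , E₁ , E₂ , u₁∈e₁ , u₂∈e₂ , ∣e₁∩e₂∣≡r∸1 with proj₂ rp' e₁ E₁ (χ' u₂)
  ...       | w , w∈e₁ , χ'w≡χ'u₂ , _ =
    ⊥-elim (2+r∸1≰r r (subst₂ (λ k l → 2 + k ≤ l) ∣e₁∩e₂∣≡r∸1 (uniform F e₁ E₁)
             (2+∣p∩q∣≤∣p∣ u₁≢w u₁∈e₁ w∈e₁ u₁∉e₂ w∉e₂)))
    where
    u₁∉e₂ : u₁ ∉ e₂
    u₁∉e₂ u₁∈e₂ = u₁≢u₂ (sameLabel-inEdge⇒≡ rp E₂ u₁∈e₂ u₂∈e₂ χu₁≡χu₂)

    u₁≢w : u₁ ≢ w
    u₁≢w u₁≡w = χ'u₁≢χ'u₂ (trans (cong χ' u₁≡w) χ'w≡χ'u₂)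

    w∉e₂ : w ∉ e₂
    w∉e₂ w∈e₂ = u₁≢u₂ (sameLabel-inEdge⇒≡ rp E₁ u₁∈e₁ u₂∈e₁ χu₁≡χu₂)
      where
      u₂∈e₁ : u₂ ∈ e₁
      u₂∈e₁ = subst (_∈ e₁) (sameLabel-inEdge⇒≡ rp' E₂ w∈e₂ u₂∈e₂ χ'w≡χ'u₂) w∈e₁

lemma2p2 : ∀ {r : ℕ} (F : RGraph r) → TightlyConnected F →
    ∃[ χ ] (IsRPartition F χ × (∀ χ' → IsRPartition F χ' → SameUpToRelabel F χ χ'))
lemma2p2 F (χ , rp , tc) = χ , rp , λ χ' rp' →
  refines⇒relabelling χ χ' (proj₁ rp) (proj₁ rp')
    (tightlyConnected⇒fibresRefine F rp tc rp')
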